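{- Let $\mathbf{A}$ be a Heyting algebra, $\mathbf{B}=s(\mathbf{A})$, $\nabla$ a filter of $\mathbf{A}$ containing all dense elements of $\mathbf{A}$, $\Delta$ an ideal of $\mathbf{A}$, and $\mathbf{T}=Tw(\mathbf{B},\rho(\nabla),\sigma(\Delta))$. Then for every formula $\varphi$ of the language $\{\wedge,\vee,\to,\bot,\sim\}$: $$\mathbf{T}\models\mathrm{T}_{\mathbf{B}}\varphi\iff Tw(\mathbf{A},\nabla,N(\Delta))\models\varphi.$$
   Context: A topological Boolean algebra (TBA) is an algebra $\langle B;\vee,\wedge,\to,\bot,\Box\rangle$ whose reduct is a Boolean algebra ($\neg_{\mathbf{B}}a:=a\to\bot$) with $\Box 1=1$, $\Box(a\wedge b)=\Box a\wedge\Box b$, $\Box a\le a$, $\Box a\le\Box\Box a$; $\Diamond a:=\neg_{\mathbf{B}}\Box\neg_{\mathbf{B}}a$. Its open elements $\{a:\Box a=a\}$ form a Heyting algebra $\mathcal{G}(\mathbf{B})$ with $\vee,\wedge,\bot$ of $\mathbf{B}$ and implication $\Box(a\to b)$. For a Heyting algebra $\mathbf{A}$, $s(\mathbf{A})$ is the TBA $\mathbf{B}$ (unique up to isomorphism) with $\mathcal{G}(\mathbf{B})=\mathbf{A}$ and generated by its open elements. In $\mathbf{A}$, $\neg a:=a\to\bot$; $a$ is dense if $\neg a=\bot$. $\rho(\nabla)=\{x\in B:\Box x\in\nabla\}$; $\sigma(\Delta)=\{x\in B:x\le\Diamond y\text{ for some }y\in\Delta\}$; $N(\Delta)=\{a\in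 A:a\le\neg\neg b\text{ for some }b\in\Delta\}$. Full twist-structure $\mathbf{C}^{\bowtie}$ over a Heyting algebra or TBA $\mathbf{C}$: universe $C\times C$, $(a,b)\vee(c,d)=(a\vee c,b\wedge d)$, $(a,b)\wedge(c,d)=(a\wedge c,b\vee d)$, $(a,b)\to(c,d)=(a\to c,a\wedge d)$, $\bot=(\bot,1)$, $\sim(a,b)=(b,a)$, and for a TBA $\Box(a,b)=(\Box a,\Diamond b)$, $\Diamond(a,b)=(\Diamond a,\Box b)$. $Tw(\mathbf{C},\nabla',\Delta')$ is the subalgebra of $\mathbf{C}^{\bowtie}$ on $\{(a,b):a\vee b\in\nabla',\ a\wedge b\in\Delta'\}$. Validity: $\mathcal{A}\models\varphi$ iff $\pi_1(v(\varphi))=1$ for every homomorphism $v$ from the formula algebra into $\mathcal{A}$. Translation $\mathrm{T}_{\mathbf{B}}$: $\mathrm{T}_{\mathbf{B}}(p)=\Box p$, $\mathrm{T}_{\mathbf{B}}(\sim p)=\Box\sim p$, $\mathrm{T}_{\mathbf{B}}(\bot)=\bot$, $\mathrm{T}_{\mathbf{B}}(\sim\bot)=\sim\bot$, $\mathrm{T}_{\mathbf{B}}(\varphi\wedge\psi)=\mathrm{T}_{\mathbf{B}}\varphi\wedge\mathrm{T}_{\mathbf{B}}\psi$, $\mathrm{T}_{\mathbf{B}}(\varphi\vee\psi)=\mathrm{T}_{\mathbf{B}}\varphi\vee\mathrm{T}_{\mathbf{B}}\psi$, $\mathrm{T}_{\mathbf{B}}(\varphi\to\psi)=\Box(\mathrm{T}_{\mathbf{B}}\varphi\to\mathrm{T}_{\mathbf{B}}\psi)$,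 $\mathrm{T}_{\mathbf{B}}(\sim(\varphi\wedge\psi))=\mathrm{T}_{\mathbf{B}}(\sim\varphi)\vee\mathrm{T}_{\mathbf{B}}(\sim\psi)$, $\mathrm{T}_{\mathbf{B}}(\sim(\varphi\vee\psi))=\mathrm{T}_{\mathbf{B}}(\sim\varphi)\wedge\mathrm{T}_{\mathbf{B}}(\sim\psi)$, $\mathrm{T}_{\mathbf{B}}(\sim(\varphi\to\psi))=\mathrm{T}_{\mathbf{B}}\varphi\wedge\mathrm{T}_{\mathbf{B}}(\sim\psi)$, $\mathrm{T}_{\mathbf{B}}(\sim\sim\varphi)=\mathrm{T}_{\mathbf{B}}\varphi$. -}

module Defs where

open import Level using (Level; _⊔_) renaming (suc to lsuc)
open import Data.Nat using (ℕ)
open import Data.Product using (Σ; ∃; _×_; _,_; proj₁; proj₂)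
open import Relation.Unary using (Pred)
open import Relation.Binary.Lattice.Bundles using (HeytingAlgebra; BooleanAlgebra)

-- Topological Boolean algebras (interior algebras).
-- The Boolean reduct is a stdlib BooleanAlgebra (order-theoretic version);
-- its implication is  a ⇨ b = ¬ a ∨ b  and  ¬ a ≈ a ⇨ ⊥.

record TBA (c ℓ₁ ℓ₂ : Level) : Set (lsuc (c ⊔ ℓ₁ ⊔ ℓ₂)) where
  field
    boolean : BooleanAlgebra c ℓ₁ ℓ₂
  open BooleanAlgebra boolean public
  field
    □       : Carrier → Carrier
    □-cong  : ∀ {a b} → a ≈ b → □ a ≈ □ b
    □-⊤     : □ ⊤ ≈ ⊤
    □-∧     : ∀ a b → □ (a ∧ b) ≈ (□ a ∧ □ b)
    □-≤     : ∀ a → □ a ≤ a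
    □-□     : ∀ a → □ a ≤ □ (□ a)
  ◇ : Carrier → Carrier
  ◇ a = ¬ (□ (¬ a))

-- B = s(A):  e : A → B is an isomorphism of A onto the Heyting algebra
-- G(B) of open elements of B, and B is generated (as a TBA) by its open
-- elements.

module _ {c ℓ₁ ℓ₂ : Level} (B : TBA c ℓ₁ ℓ₂) where
  open TBA B

  data GenByOpen : Carrier → Set (c ⊔ ℓ₁) where
    g-open : ∀ {x} → □ x ≈ x → GenByOpen x
    g-≈    : ∀ {x y} → GenByOpen x → x ≈ y → GenByOpen y
    g-∨    : ∀ {x y} → GenByOpen x → GenByOpen y → GenByOpen (x ∨ y)
    g-∧    : ∀ {x y} → GenByOpen x → GenByOpen y → GenByOpen (x ∧ y)
    g-⇨    : ∀ {x y} → GenByOpen x → GenByOpen y → GenByOpen (x ⇨ y)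
    g-⊥    : GenByOpen ⊥
    g-□    : ∀ {x} → GenByOpen x → GenByOpen (□ x)

record IsSOf {a ℓa₁ ℓa₂ c ℓ₁ ℓ₂ : Level}
             (A : HeytingAlgebra a ℓa₁ ℓa₂) (B : TBA c ℓ₁ ℓ₂)
             (e : HeytingAlgebra.Carrier A → TBA.Carrier B)
             : Set (a ⊔ ℓa₁ ⊔ ℓa₂ ⊔ c ⊔ ℓ₁ ⊔ ℓ₂) where
  private
    module A = HeytingAlgebra A
    module B = TBA B
  field
    e-cong      : ∀ {x y} → x A.≈ y → e x B.≈ e y
    e-injective : ∀ {x y} → e x B.≈ e y → x A.≈ y
    e-open      : ∀ x → B.□ (e x) B.≈ e x
    e-onto-open : ∀ y → B.□ y B.≈ y → ∃ λ x → e x B.≈ y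
    e-∨         : ∀ x y → e (x A.∨ y) B.≈ (e x B.∨ e y)
    e-∧         : ∀ x y → e (x A.∧ y) B.≈ (e x B.∧ e y)
    e-⊥         : e A.⊥ B.≈ B.⊥
    e-⊤         : e A.⊤ B.≈ B.⊤
    e-⇨         : ∀ x y → e (x A.⇨ y) B.≈ B.□ (e x B.⇨ e y)
    generated   : ∀ y → GenByOpen B y

module _ {a ℓ₁ ℓ₂ : Level} (A : HeytingAlgebra a ℓ₁ ℓ₂) where
  open HeytingAlgebra A

  record IsFilter {p : Level} (F : Pred Carrier p) : Set (a ⊔ ℓ₁ ⊔ ℓ₂ ⊔ p) where
    field
      ⊤∈   : F ⊤
      up   : ∀ {x y} → F x → x ≤ y → F y
      ∧∈   : ∀ {x y} → F x → F y → F (x ∧ y)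

  record IsIdeal {p : Level} (I : Pred Carrier p) : Set (a ⊔ ℓ₁ ⊔ ℓ₂ ⊔ p) where
    field
      ⊥∈   : I ⊥
      down : ∀ {x y} → I x → y ≤ x → I y
      ∨∈   : ∀ {x y} → I x → I y → I (x ∨ y)

  ¬H : Carrier → Carrier
  ¬H x = x ⇨ ⊥

  Dense : Carrier → Set ℓ₁
  Dense x = ¬H x ≈ ⊥

  N : {p : Level} → Pred Carrier p → Pred Carrier (a ⊔ ℓ₂ ⊔ p)
  N Δ x = ∃ λ b → Δ b × (x ≤ ¬H (¬H b))

-- ρ(∇) = { x ∈ B : □ x ∈ ∇ }   (∇ ⊆ A ≅ G(B) via e)
ρ : {a ℓa₁ ℓa₂ c ℓ₁ ℓ₂ p : Level}
    (A : HeytingAlgebra a ℓa₁ ℓa₂) (B : TBA c ℓ₁ ℓ₂)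
    (e : HeytingAlgebra.Carrier A → TBA.Carrier B) →
    Pred (HeytingAlgebra.Carrier A) p → Pred (TBA.Carrier B) (a ⊔ ℓ₁ ⊔ p)
ρ A B e ∇ x = ∃ λ y → ∇ y × (TBA._≈_ B (TBA.□ B x) (e y))

σ : {a ℓa₁ ℓa₂ c ℓ₁ ℓ₂ p : Level}
    (A : HeytingAlgebra a ℓa₁ ℓa₂) (B : TBA c ℓ₁ ℓ₂)
    (e : HeytingAlgebra.Carrier A → TBA.Carrier B) →
    Pred (HeytingAlgebra.Carrier A) p → Pred (TBA.Carrier B) (a ⊔ ℓ₂ ⊔ p)
σ A B e Δ x = ∃ λ y → Δ y × (TBA._≤_ B x (TBA.◇ B (e y)))

infixr 5 _⟶_
infixr 6 _⋁_
infixr 7 _⋀_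
infix  8 ∼_

data Fm : Set where
  var  : ℕ → Fm
  _⋀_  : Fm → Fm → Fm
  _⋁_  : Fm → Fm → Fm
  _⟶_  : Fm → Fm → Fm
  ⊥f   : Fm
  ∼_   : Fm → Fm

data Fm□ : Set where
  var  : ℕ → Fm□
  _⋀_  : Fm□ → Fm□ → Fm□
  _⋁_  : Fm□ → Fm□ → Fm□
  _⟶_  : Fm□ → Fm□ → Fm□
  ⊥f   : Fm□
  ∼_   : Fm□ → Fm□
  □f   : Fm□ → Fm□

mutual
  TB : Fm → Fm□
  TB (var n)   = □f (var n)
  TB (φ ⋀ ψ)   = TB φ ⋀ TB ψ
  TB (φ ⋁ ψ)   = TB φ ⋁ TB ψ
  TB (φ ⟶ ψ)   = □f (TB φ ⟶ TB ψ)
  TB ⊥f        = ⊥f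
  TB (∼ φ)     = TB∼ φ

  TB∼ : Fm → Fm□
  TB∼ (var n)  = □f (∼ var n)
  TB∼ (φ ⋀ ψ)  = TB∼ φ ⋁ TB∼ ψ
  TB∼ (φ ⋁ ψ)  = TB∼ φ ⋀ TB∼ ψ
  TB∼ (φ ⟶ ψ)  = TB φ ⋀ TB∼ ψ
  TB∼ ⊥f       = ∼ ⊥f
  TB∼ (∼ φ)    = TB φ

module TwistH {a ℓ₁ ℓ₂ : Level} (A : HeytingAlgebra a ℓ₁ ℓ₂) where
  open HeytingAlgebra A

  Pair : Set a
  Pair = Carrier × Carrier

  tw∧ tw∨ tw⇒ : Pair → Pair → Pair
  tw∧ (x , y) (z , w) = (x ∧ z , y ∨ w)
  tw∨ (x , y) (z , w) = (x ∨ z , y ∧ w)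
  tw⇒ (x , y) (z , w) = (x ⇨ z , x ∧ w)
  tw∼ : Pair → Pair
  tw∼ (x , y) = (y , x)

  eval : (ℕ → Pair) → Fm → Pair
  eval v (var n)  = v n
  eval v (φ ⋀ ψ)  = tw∧ (eval v φ) (eval v ψ)
  eval v (φ ⋁ ψ)  = tw∨ (eval v φ) (eval v ψ)
  eval v (φ ⟶ ψ)  = tw⇒ (eval v φ) (eval v ψ)
  eval v ⊥f       = (⊥ , ⊤)
  eval v (∼ φ)    = tw∼ (eval v φ)

  InTw : {p q : Level} → Pred Carrier p → Pred Carrier q → Pair → Set (p ⊔ q)
  InTw ∇' Δ' (x , y) = ∇' (x ∨ y) × Δ' (x ∧ y)

  Valid : {p q : Level} → Pred Carrier p → Pred Carrier q → Fm → Set (a ⊔ ℓ₁ ⊔ p ⊔ q)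
  Valid ∇' Δ' φ = ∀ (v : ℕ → Pair) → (∀ n → InTw ∇' Δ' (v n)) → proj₁ (eval v φ) ≈ ⊤

module TwistB {c ℓ₁ ℓ₂ : Level} (B : TBA c ℓ₁ ℓ₂) where
  open TBA B

  Pair : Set c
  Pair = Carrier × Carrier

  tw∧ tw∨ tw⇒ : Pair → Pair → Pair
  tw∧ (x , y) (z , w) = (x ∧ z , y ∨ w)
  tw∨ (x , y) (z , w) = (x ∨ z , y ∧ w)
  tw⇒ (x , y) (z , w) = (x ⇨ z , x ∧ w)
  tw∼ tw□ : Pair → Pair
  tw∼ (x , y) = (y , x)
  tw□ (x , y) = (□ x , ◇ y)

  eval : (ℕ → Pair) → Fm□ → Pair
  eval v (var n)  = v n
  eval v (φ ⋀ ψ)  = tw∧ (eval v φ) (eval v ψ)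
  eval v (φ ⋁ ψ)  = tw∨ (eval v φ) (eval v ψ)
  eval v (φ ⟶ ψ)  = tw⇒ (eval v φ) (eval v ψ)
  eval v ⊥f       = (⊥ , ⊤)
  eval v (∼ φ)    = tw∼ (eval v φ)
  eval v (□f φ)   = tw□ (eval v φ)

  InTw : {p q : Level} → Pred Carrier p → Pred Carrier q → Pair → Set (p ⊔ q)
  InTw ∇' Δ' (x , y) = ∇' (x ∨ y) × Δ' (x ∧ y)

  Valid : {p q : Level} → Pred Carrier p → Pred Carrier q → Fm□ → Set (c ⊔ ℓ₁ ⊔ p ⊔ q)
  Valid ∇' Δ' φ = ∀ (v : ℕ → Pair) → (∀ n → InTw ∇' Δ' (v n)) → proj₁ (eval v φ) ≈ ⊤

module Submission where

-- The two twist structures are compared through the isomorphism e : A ≅ G(B) and the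
-- map □ᴬ : x ↦ e⁻¹(□ x).  If □ v = e w holds coordinatewise for valuations v into T and w
-- into Tw(A, ∇, N(Δ)), then T_B φ evaluates under v to e of the first coordinate of φ
-- under w (and T_B(∼ φ) to e of the second), so validity transfers as soon as every
-- valuation on either side has such a partner.  The only nontrivial membership check
-- is □ x ∨ □ y ∈ ∇ whenever □ (x ∨ y) ∈ ∇: since B is generated by its open elements,
-- every x has nowhere dense boundary, i.e. □ x ∨ □ ¬ x is a dense open element; it
-- therefore lies in ∇, and □ (x ∨ y) ∧ (□ x ∨ □ ¬ x) ≤ □ x ∨ □ y.

open import Defs
open import Level using (Level)
open import Data.Nat using (ℕ)
open import Data.Product using (_×_; _,_; proj₁; proj₂; map)
open import Function using (_∘_)
open import Relation.Unary using (Pred)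
open import Relation.Binary.Lattice.Bundles
  using (DistributiveLattice; HeytingAlgebra; BooleanAlgebra)
import Relation.Binary.Lattice.Properties.DistributiveLattice as DistributiveLatticeProperties
import Relation.Binary.Lattice.Properties.HeytingAlgebra as HeytingAlgebraProperties
import Relation.Binary.Lattice.Properties.JoinSemilattice as JoinSemilatticeProperties
import Relation.Binary.Lattice.Properties.MeetSemilattice as MeetSemilatticeProperties
import Relation.Binary.Reasoning.PartialOrder as ≤-Reasoning

module DistributiveLatticeCases {c ℓ₁ ℓ₂ : Level} (L : DistributiveLattice c ℓ₁ ℓ₂) where
  open DistributiveLattice L
  open DistributiveLatticeProperties L using (∧-distribʳ-∨)
  open JoinSemilatticeProperties joinSemilattice using (∨-cong)
  open ≤-Reasoning poset

  ∧-∨-elim : ∀ {x y w z} → x ∧ y ≤ z → x ∧ w ≤ z → x ∧ (y ∨ w) ≤ z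
  ∧-∨-elim {x} {y} {w} {z} xy xw = begin
    x ∧ (y ∨ w)    ≈⟨ ∧-distribˡ-∨ x y w ⟩
    x ∧ y ∨ x ∧ w  ≤⟨ ∨-least xy xw ⟩
    z              ∎

  ∨-∧-∨-elim : ∀ {a b c d z} → a ∧ c ≤ z → a ∧ d ≤ z → b ∧ c ≤ z → b ∧ d ≤ z →
               (a ∨ b) ∧ (c ∨ d) ≤ z
  ∨-∧-∨-elim {a} {b} {c} {d} {z} ac ad bc bd = begin
    (a ∨ b) ∧ (c ∨ d)          ≈⟨ ∧-distribʳ-∨ (c ∨ d) a b ⟩
    a ∧ (c ∨ d) ∨ b ∧ (c ∨ d)  ≤⟨ ∨-least (∧-∨-elim ac ad) (∧-∨-elim bc bd) ⟩
    z                          ∎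

module BooleanAlgebraProperties {c ℓ₁ ℓ₂ : Level} (L : BooleanAlgebra c ℓ₁ ℓ₂) where
  open BooleanAlgebra L
  open HeytingAlgebraProperties heytingAlgebra using (distributiveLattice)
  open HeytingAlgebraProperties heytingAlgebra public using (⇨-cong)
  open DistributiveLatticeCases distributiveLattice public
  open MeetSemilatticeProperties meetSemilattice public using (∧-monotonic; ∧-comm; ∧-cong)
  open JoinSemilatticeProperties joinSemilattice public using (∨-monotonic; ∨-cong)

  ¬x∧x≤⊥ : ∀ {x} → ¬ x ∧ x ≤ ⊥
  ¬x∧x≤⊥ {x} = transpose-∧ (x≤x∨y (¬ x) ⊥)

  x∧¬x≤⊥ : ∀ {x} → x ∧ ¬ x ≤ ⊥
  x∧¬x≤⊥ = trans (reflexive (∧-comm _ _)) ¬x∧x≤⊥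

  ¬-intro : ∀ {w x} → w ∧ x ≤ ⊥ → w ≤ ¬ x
  ¬-intro w∧x≤⊥ = trans (transpose-⇨ w∧x≤⊥) (∨-least refl (minimum _))

  ¬-antitone : ∀ {x y} → x ≤ y → ¬ y ≤ ¬ x
  ¬-antitone x≤y = ¬-intro (trans (∧-monotonic refl x≤y) ¬x∧x≤⊥)

  ¬-cong : ∀ {x y} → x ≈ y → ¬ x ≈ ¬ y
  ¬-cong x≈y = antisym (¬-antitone (reflexive (Eq.sym x≈y))) (¬-antitone (reflexive x≈y))

  x≤¬¬x : ∀ {x} → x ≤ ¬ ¬ x
  x≤¬¬x = ¬-intro x∧¬x≤⊥

  ¬x∧¬y≤¬[x∨y] : ∀ {x y} → ¬ x ∧ ¬ y ≤ ¬ (x ∨ y)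
  ¬x∧¬y≤¬[x∨y] = ¬-intro (∧-∨-elim (trans (∧-monotonic (x∧y≤x _ _) refl) ¬x∧x≤⊥)
                                   (trans (∧-monotonic (x∧y≤y _ _) refl) ¬x∧x≤⊥))

  disjunctive-syllogism : ∀ {x y} → (x ∨ y) ∧ ¬ x ≤ y
  disjunctive-syllogism = trans (reflexive (∧-comm _ _))
                                (∧-∨-elim (trans ¬x∧x≤⊥ (minimum _)) (x∧y≤y _ _))

  ¬[x∧y]∧x≤¬y : ∀ {x y} → ¬ (x ∧ y) ∧ x ≤ ¬ y
  ¬[x∧y]∧x≤¬y = ¬-intro (trans (∧-greatest (trans (x∧y≤x _ _) (x∧y≤x _ _))
                                           (∧-monotonic (x∧y≤y _ _) refl))
                               ¬x∧x≤⊥)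

module InteriorAlgebraProperties {c ℓ₁ ℓ₂ : Level} (B : TBA c ℓ₁ ℓ₂) where
  open TBA B
  open BooleanAlgebraProperties boolean public
  open ≤-Reasoning poset

  □-mono : ∀ {x y} → x ≤ y → □ x ≤ □ y
  □-mono {x} {y} x≤y = begin
    □ x          ≈⟨ □-cong (antisym (∧-greatest refl x≤y) (x∧y≤x _ _)) ⟩
    □ (x ∧ y)    ≈⟨ □-∧ x y ⟩
    □ x ∧ □ y    ≤⟨ x∧y≤y _ _ ⟩
    □ y          ∎

  □-idempotent : ∀ x → □ (□ x) ≈ □ x
  □-idempotent x = antisym (□-≤ _) (□-□ _)

  □-∨-split : ∀ x y → □ (x ∨ y) ∧ (□ x ∨ □ (¬ x)) ≤ □ x ∨ □ y
  □-∨-split x y = ∧-∨-elim (trans (x∧y≤y _ _) (x≤x∨y _ _)) (begin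
    □ (x ∨ y) ∧ □ (¬ x)  ≈⟨ □-∧ _ _ ⟨
    □ ((x ∨ y) ∧ ¬ x)    ≤⟨ □-mono disjunctive-syllogism ⟩
    □ y                  ≤⟨ y≤x∨y _ _ ⟩
    □ x ∨ □ y            ∎)

  -- u is dense in the topological sense: its closure ◇ u is everything.
  Dense◇ : Carrier → Set ℓ₂
  Dense◇ u = □ (¬ u) ≤ ⊥

  dense◇-mono : ∀ {u v} → u ≤ v → Dense◇ u → Dense◇ v
  dense◇-mono u≤v = trans (□-mono (¬-antitone u≤v))

  dense◇-∧ : ∀ {u v} → □ u ≈ u → Dense◇ u → Dense◇ v → Dense◇ (u ∧ v)
  dense◇-∧ {u} {v} u-open u-dense v-dense = begin
    □ (¬ (u ∧ v))      ≤⟨ □-□ _ ⟩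
    □ (□ (¬ (u ∧ v)))  ≤⟨ □-mono (¬-intro w∧u≤⊥) ⟩
    □ (¬ u)            ≤⟨ u-dense ⟩
    ⊥                  ∎
    where
    w : Carrier
    w = □ (¬ (u ∧ v))
    -- w ∧ u is open and lies below ¬ v.
    w∧u≤⊥ : w ∧ u ≤ ⊥
    w∧u≤⊥ = begin
      w ∧ u      ≈⟨ ∧-cong (□-idempotent _) u-open ⟨
      □ w ∧ □ u  ≈⟨ □-∧ _ _ ⟨
      □ (w ∧ u)  ≤⟨ □-mono (trans (∧-monotonic (□-≤ _) refl) ¬[x∧y]∧x≤¬y) ⟩
      □ (¬ v)    ≤⟨ v-dense ⟩
      ⊥          ∎

  □[□x∨□y]≈□x∨□y : ∀ x y → □ (□ x ∨ □ y) ≈ □ x ∨ □ y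
  □[□x∨□y]≈□x∨□y x y = antisym (□-≤ _)
    (∨-least (trans (□-□ _) (□-mono (x≤x∨y _ _))) (trans (□-□ _) (□-mono (y≤x∨y _ _))))

  -- Equivalently, the boundary ◇ x ∧ ◇ (¬ x) of x is nowhere dense.
  Decided : Carrier → Set ℓ₂
  Decided x = Dense◇ (□ x ∨ □ (¬ x))

  decided-open : ∀ {x} → □ x ≈ x → Decided x
  decided-open {x} x-open = trans (∧-greatest below-□¬x below-¬□¬x) x∧¬x≤⊥
    where
    below-□¬x : □ (¬ (□ x ∨ □ (¬ x))) ≤ □ (¬ x)
    below-□¬x = □-mono (trans (¬-antitone (x≤x∨y _ _)) (reflexive (¬-cong x-open)))
    below-¬□¬x : □ (¬ (□ x ∨ □ (¬ x))) ≤ ¬ □ (¬ x)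
    below-¬□¬x = trans (□-≤ _) (¬-antitone (y≤x∨y _ _))

  decided-≈ : ∀ {x y} → x ≈ y → Decided x → Decided y
  decided-≈ x≈y = dense◇-mono (∨-monotonic (□-mono (reflexive x≈y))
                                           (□-mono (¬-antitone (reflexive (Eq.sym x≈y)))))

  decided-¬ : ∀ {x} → Decided x → Decided (¬ x)
  decided-¬ = dense◇-mono (∨-least (trans (□-mono x≤¬¬x) (y≤x∨y _ _)) (x≤x∨y _ _))

  decided-from : ∀ {x y z} → Decided x → Decided y →
                 (□ x ∨ □ (¬ x)) ∧ (□ y ∨ □ (¬ y)) ≤ □ z ∨ □ (¬ z) → Decided z
  decided-from {x} x-decided y-decided covers =
    dense◇-mono covers (dense◇-∧ (□[□x∨□y]≈□x∨□y x (¬ x)) x-decided y-decided)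

  decided-∨ : ∀ {x y} → Decided x → Decided y → Decided (x ∨ y)
  decided-∨ {x} {y} x-decided y-decided = decided-from x-decided y-decided
    (∨-∧-∨-elim (trans (x∧y≤x _ _) □x≤□[x∨y]) (trans (x∧y≤x _ _) □x≤□[x∨y])
                (trans (x∧y≤y _ _) □y≤□[x∨y])
                (trans (reflexive (Eq.sym (□-∧ _ _)))
                       (trans (□-mono ¬x∧¬y≤¬[x∨y]) (y≤x∨y _ _))))
    where
    □x≤□[x∨y] : □ x ≤ □ (x ∨ y) ∨ □ (¬ (x ∨ y))
    □x≤□[x∨y] = trans (□-mono (x≤x∨y _ _)) (x≤x∨y _ _)
    □y≤□[x∨y] : □ y ≤ □ (x ∨ y) ∨ □ (¬ (x ∨ y))
    □y≤□[x∨y] = trans (□-mono (y≤x∨y _ _)) (x≤x∨y _ _)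

  decided-∧ : ∀ {x y} → Decided x → Decided y → Decided (x ∧ y)
  decided-∧ {x} {y} x-decided y-decided = decided-from x-decided y-decided
    (∨-∧-∨-elim (trans (reflexive (Eq.sym (□-∧ _ _))) (x≤x∨y _ _))
                (trans (x∧y≤y _ _) □¬y≤□¬[x∧y])
                (trans (x∧y≤x _ _) □¬x≤□¬[x∧y])
                (trans (x∧y≤y _ _) □¬y≤□¬[x∧y]))
    where
    □¬x≤□¬[x∧y] : □ (¬ x) ≤ □ (x ∧ y) ∨ □ (¬ (x ∧ y))
    □¬x≤□¬[x∧y] = trans (□-mono (¬-antitone (x∧y≤x _ _))) (y≤x∨y _ _)
    □¬y≤□¬[x∧y] : □ (¬ y) ≤ □ (x ∧ y) ∨ □ (¬ (x ∧ y))
    □¬y≤□¬[x∧y] = trans (□-mono (¬-antitone (x∧y≤y _ _))) (y≤x∨y _ _)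

  generated⇒decided : ∀ {x} → GenByOpen B x → Decided x
  generated⇒decided (g-open x-open) = decided-open x-open
  generated⇒decided (g-≈ g x≈y)     = decided-≈ x≈y (generated⇒decided g)
  generated⇒decided (g-∨ g h)       = decided-∨ (generated⇒decided g) (generated⇒decided h)
  generated⇒decided (g-∧ g h)       = decided-∧ (generated⇒decided g) (generated⇒decided h)
  generated⇒decided (g-⇨ g h)       =
    decided-∨ (decided-¬ (generated⇒decided g)) (generated⇒decided h)
  generated⇒decided g-⊥             = decided-open (antisym (□-≤ _) (minimum _))
  generated⇒decided (g-□ g)         = decided-open (□-idempotent _)

module OpenElementRepresentation {a ℓa₁ ℓa₂ c ℓ₁ ℓ₂ : Level}
    (A : HeytingAlgebra a ℓa₁ ℓa₂) (B : TBA c ℓ₁ ℓ₂)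
    (e : HeytingAlgebra.Carrier A → TBA.Carrier B) (s : IsSOf A B e) where
  private
    module A = HeytingAlgebra A
    module AM = MeetSemilatticeProperties A.meetSemilattice
  open TBA B
  open InteriorAlgebraProperties B
  open MeetSemilatticeProperties meetSemilattice using (y≤x⇒x∧y≈y)
  open IsSOf s
  open ≤-Reasoning poset

  e-mono : ∀ {x y} → x A.≤ y → e x ≤ e y
  e-mono {x} {y} x≤y = begin
    e x          ≈⟨ e-cong (AM.y≤x⇒x∧y≈y x≤y) ⟨
    e (y A.∧ x)  ≈⟨ e-∧ y x ⟩
    e y ∧ e x    ≤⟨ x∧y≤x _ _ ⟩
    e y          ∎

  e-reflects-≤ : ∀ {x y} → e x ≤ e y → x A.≤ y
  e-reflects-≤ {x} {y} ex≤ey = A.trans (A.reflexive (A.Eq.sym y∧x≈x)) (A.x∧y≤x _ _)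
    where
    y∧x≈x : y A.∧ x A.≈ x
    y∧x≈x = e-injective (Eq.trans (e-∧ y x) (y≤x⇒x∧y≈y ex≤ey))

  e-¬ : ∀ x → e (¬H A x) ≈ □ (¬ e x)
  e-¬ x = begin-equality
    e (x A.⇨ A.⊥)       ≈⟨ e-⇨ x A.⊥ ⟩
    □ (¬ e x ∨ e A.⊥)   ≈⟨ □-cong (∨-cong Eq.refl e-⊥) ⟩
    □ (¬ e x ∨ ⊥)       ≈⟨ □-cong (antisym (∨-least refl (minimum _)) (x≤x∨y _ _)) ⟩
    □ (¬ e x)           ∎

  e-¬¬ : ∀ x → e (¬H A (¬H A x)) ≈ □ (◇ (e x))
  e-¬¬ x = Eq.trans (e-¬ _) (□-cong (¬-cong (e-¬ x)))

  □ᴬ : Carrier → A.Carrier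
  □ᴬ x = proj₁ (e-onto-open (□ x) (□-idempotent x))

  e-□ᴬ : ∀ x → e (□ᴬ x) ≈ □ x
  e-□ᴬ x = proj₂ (e-onto-open (□ x) (□-idempotent x))

  e-□ᴬ-∨ : ∀ x y → e (□ᴬ x A.∨ □ᴬ y) ≈ □ x ∨ □ y
  e-□ᴬ-∨ x y = Eq.trans (e-∨ _ _) (∨-cong (e-□ᴬ x) (e-□ᴬ y))

  e-□ᴬ-∧ : ∀ x y → e (□ᴬ x A.∧ □ᴬ y) ≈ □ x ∧ □ y
  e-□ᴬ-∧ x y = Eq.trans (e-∧ _ _) (∧-cong (e-□ᴬ x) (e-□ᴬ y))

  decided⇒dense : ∀ {x} → Decided x → Dense A (□ᴬ x A.∨ □ᴬ (¬ x))
  decided⇒dense {x} x-decided = e-injective (antisym (begin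
    e (¬H A (□ᴬ x A.∨ □ᴬ (¬ x)))    ≈⟨ e-¬ _ ⟩
    □ (¬ e (□ᴬ x A.∨ □ᴬ (¬ x)))     ≈⟨ □-cong (¬-cong (e-□ᴬ-∨ x (¬ x))) ⟩
    □ (¬ (□ x ∨ □ (¬ x)))           ≤⟨ x-decided ⟩
    ⊥                               ≈⟨ e-⊥ ⟨
    e A.⊥                           ∎) (trans (reflexive e-⊥) (minimum _)))

  module Translation (v : ℕ → TwistB.Pair B) (w : ℕ → TwistH.Pair A)
                     (agree₁ : ∀ n → □ (proj₁ (v n)) ≈ e (proj₁ (w n)))
                     (agree₂ : ∀ n → □ (proj₂ (v n)) ≈ e (proj₂ (w n))) where
    mutual
      TB-eval : ∀ φ → proj₁ (TwistB.eval B v (TB φ)) ≈ e (proj₁ (TwistH.eval A w φ))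
      TB-eval (var n) = agree₁ n
      TB-eval (φ ⋀ ψ) = Eq.trans (∧-cong (TB-eval φ) (TB-eval ψ)) (Eq.sym (e-∧ _ _))
      TB-eval (φ ⋁ ψ) = Eq.trans (∨-cong (TB-eval φ) (TB-eval ψ)) (Eq.sym (e-∨ _ _))
      TB-eval (φ ⟶ ψ) = Eq.trans (□-cong (⇨-cong (TB-eval φ) (TB-eval ψ))) (Eq.sym (e-⇨ _ _))
      TB-eval ⊥f      = Eq.sym e-⊥
      TB-eval (∼ φ)   = TB∼-eval φ

      TB∼-eval : ∀ φ → proj₁ (TwistB.eval B v (TB∼ φ)) ≈ e (proj₂ (TwistH.eval A w φ))
      TB∼-eval (var n) = agree₂ n
      TB∼-eval (φ ⋀ ψ) = Eq.trans (∨-cong (TB∼-eval φ) (TB∼-eval ψ)) (Eq.sym (e-∨ _ _))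
      TB∼-eval (φ ⋁ ψ) = Eq.trans (∧-cong (TB∼-eval φ) (TB∼-eval ψ)) (Eq.sym (e-∧ _ _))
      TB∼-eval (φ ⟶ ψ) = Eq.trans (∧-cong (TB-eval φ) (TB∼-eval ψ)) (Eq.sym (e-∧ _ _))
      TB∼-eval ⊥f      = Eq.sym e-⊤
      TB∼-eval (∼ φ)   = TB-eval φ

  e-∨∈ρ : ∀ {p} {∇ : Pred A.Carrier p} {x y} → ∇ (x A.∨ y) → ρ A B e ∇ (e x ∨ e y)
  e-∨∈ρ {x = x} {y} x∨y∈∇ = x A.∨ y , x∨y∈∇ , (begin-equality
    □ (e x ∨ e y)    ≈⟨ □-cong (e-∨ x y) ⟨
    □ (e (x A.∨ y))  ≈⟨ e-open _ ⟩
    e (x A.∨ y)      ∎)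

  e-∧∈σ : ∀ {q} {Δ : Pred A.Carrier q} {x y} → N A Δ (x A.∧ y) → σ A B e Δ (e x ∧ e y)
  e-∧∈σ {x = x} {y} (b , b∈Δ , x∧y≤¬¬b) = b , b∈Δ , (begin
    e x ∧ e y             ≈⟨ e-∧ x y ⟨
    e (x A.∧ y)           ≤⟨ e-mono x∧y≤¬¬b ⟩
    e (¬H A (¬H A b))     ≈⟨ e-¬¬ b ⟩
    □ (◇ (e b))           ≤⟨ □-≤ _ ⟩
    ◇ (e b)               ∎)

  □ᴬ-∧∈N : ∀ {q} {Δ : Pred A.Carrier q} {x y} → σ A B e Δ (x ∧ y) → N A Δ (□ᴬ x A.∧ □ᴬ y)
  □ᴬ-∧∈N {x = x} {y} (b , b∈Δ , x∧y≤◇eb) = b , b∈Δ , e-reflects-≤ (begin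
    e (□ᴬ x A.∧ □ᴬ y)     ≈⟨ e-□ᴬ-∧ x y ⟩
    □ x ∧ □ y             ≈⟨ □-∧ x y ⟨
    □ (x ∧ y)             ≤⟨ □-mono x∧y≤◇eb ⟩
    □ (◇ (e b))           ≈⟨ e-¬¬ b ⟨
    e (¬H A (¬H A b))     ∎)

  validᴮ⇒validᴬ : ∀ {p q} (∇ : Pred A.Carrier p) (Δ : Pred A.Carrier q) φ →
                  TwistB.Valid B (ρ A B e ∇) (σ A B e Δ) (TB φ) → TwistH.Valid A ∇ (N A Δ) φ
  validᴮ⇒validᴬ ∇ Δ φ valid w w∈Tw = e-injective (begin-equality
    e (proj₁ (TwistH.eval A w φ))   ≈⟨ TB-eval φ ⟨
    proj₁ (TwistB.eval B v (TB φ))  ≈⟨ valid v v∈Tw ⟩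
    ⊤                               ≈⟨ e-⊤ ⟨
    e A.⊤                           ∎)
    where
    v : ℕ → TwistB.Pair B
    v = map e e ∘ w
    v∈Tw : ∀ n → TwistB.InTw B (ρ A B e ∇) (σ A B e Δ) (v n)
    v∈Tw n = e-∨∈ρ (proj₁ (w∈Tw n)) , e-∧∈σ (proj₂ (w∈Tw n))
    open Translation v w (λ _ → e-open _) (λ _ → e-open _)

  module _ {p q : Level} {∇ : Pred A.Carrier p} (∇-filter : IsFilter A ∇)
           (dense∈∇ : ∀ x → Dense A x → ∇ x) (Δ : Pred A.Carrier q) where
    open IsFilter ∇-filter

    □ᴬ-∨∈∇ : ∀ {x y} → ρ A B e ∇ (x ∨ y) → ∇ (□ᴬ x A.∨ □ᴬ y)
    □ᴬ-∨∈∇ {x} {y} (z , z∈∇ , □[x∨y]≈ez) =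
      up (∧∈ z∈∇ (dense∈∇ _ (decided⇒dense (generated⇒decided (generated x)))))
         (e-reflects-≤ (begin
           e (z A.∧ (□ᴬ x A.∨ □ᴬ (¬ x)))       ≈⟨ e-∧ _ _ ⟩
           e z ∧ e (□ᴬ x A.∨ □ᴬ (¬ x))         ≈⟨ ∧-cong (Eq.sym □[x∨y]≈ez) (e-□ᴬ-∨ x (¬ x)) ⟩
           □ (x ∨ y) ∧ (□ x ∨ □ (¬ x))         ≤⟨ □-∨-split x y ⟩
           □ x ∨ □ y                           ≈⟨ e-□ᴬ-∨ x y ⟨
           e (□ᴬ x A.∨ □ᴬ y)                   ∎))

    validᴬ⇒validᴮ : ∀ φ → TwistH.Valid A ∇ (N A Δ) φ →
                    TwistB.Valid B (ρ A B e ∇) (σ A B e Δ) (TB φ)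
    validᴬ⇒validᴮ φ valid v v∈Tw = begin-equality
      proj₁ (TwistB.eval B v (TB φ))  ≈⟨ TB-eval φ ⟩
      e (proj₁ (TwistH.eval A w φ))   ≈⟨ e-cong (valid w w∈Tw) ⟩
      e A.⊤                           ≈⟨ e-⊤ ⟩
      ⊤                               ∎
      where
      w : ℕ → TwistH.Pair A
      w = map □ᴬ □ᴬ ∘ v
      w∈Tw : ∀ n → TwistH.InTw A ∇ (N A Δ) (w n)
      w∈Tw n = □ᴬ-∨∈∇ (proj₁ (v∈Tw n)) , □ᴬ-∧∈N (proj₂ (v∈Tw n))
      open Translation v w (λ _ → Eq.sym (e-□ᴬ _)) (λ _ → Eq.sym (e-□ᴬ _))

theorem3p3p2 : {a ℓa₁ ℓa₂ c ℓ₁ ℓ₂ p q : Level}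
    (A : HeytingAlgebra a ℓa₁ ℓa₂) (B : TBA c ℓ₁ ℓ₂)
    (e : HeytingAlgebra.Carrier A → TBA.Carrier B) → IsSOf A B e →
    (∇ : Pred (HeytingAlgebra.Carrier A) p) → IsFilter A ∇ →
    (∀ x → Dense A x → ∇ x) →
    (Δ : Pred (HeytingAlgebra.Carrier A) q) → IsIdeal A Δ →
    (φ : Fm) →
    (TwistB.Valid B (ρ A B e ∇) (σ A B e Δ) (TB φ) → TwistH.Valid A ∇ (N A Δ) φ)
    × (TwistH.Valid A ∇ (N A Δ) φ → TwistB.Valid B (ρ A B e ∇) (σ A B e Δ) (TB φ))
-- The argument does not need Δ to be an ideal.
theorem3p3p2 A B e s ∇ ∇-filter dense∈∇ Δ _ φ =
  validᴮ⇒validᴬ ∇ Δ φ , validᴬ⇒validᴮ ∇-filter dense∈∇ Δ φ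
  where open OpenElementRepresentation A B e s
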